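{- (a) If $G$ and $H$ are (not necessarily connected) graphs with clique number at least two, and $G$ and $H$ are not both complete graphs, then $$\min\{\omega(G),\omega(H)\}+1\le \mathrm{mob}(G\vee H)\le \omega(G)+\omega(H)-1.$$ (b) For any graph $G$ of order $n\ge 2$, $2\le \mathrm{mob}(G\vee K_1)\le \omega(G)+1$.
   Context: $\omega(G)$ is the clique number of $G$. The join $G\vee H$ is the disjoint union of $G$ and $H$ with all edges between $V(G)$ and $V(H)$ added. A set $S\subseteq V(G)$ is a general position set if no three vertices of $S$ lie on a common shortest path. Robots are placed one per vertex of a general position set $S$; a move $u\to v$ along an edge $uv$ with $u\in S$ is legal if $v\notin S$ and $(S\setminus\{u\})\cup\{v\}$ is a general position set. $S$ is a mobile general position set if some sequence of legal moves starting from $S$ visits every vertex at least once; $\mathrm{mob}(G)$ is the maximum size of a mobile general position set. -}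

module Defs where

open import Data.Nat using (ℕ; zero; suc; _≤_)
open import Data.Bool using (Bool; true; false; T)
open import Data.Fin using (Fin; splitAt)
open import Data.Fin.Subset using (Subset; _∈_; _∉_; _∪_; ∣_∣; inside; outside)
open import Data.Vec using (_[_]≔_)
open import Data.Sum using (_⊎_; inj₁; inj₂)
open import Data.Product using (Σ; ∃; ∃-syntax; _×_; _,_)
open import Relation.Binary.PropositionalEquality using (_≡_; _≢_; refl)
open import Relation.Nullary using (¬_)

record Graph (n : ℕ) : Set where
  field
    adj    : Fin n → Fin n → Bool
    sym    : ∀ u v → adj u v ≡ adj v u
    irrefl : ∀ u → adj u u ≡ false

open Graph public

Adj : ∀ {n} → Graph n → Fin n → Fin n → Set
Adj G u v = T (adj G u v)

Complete : ∀ {n} → Graph n → Set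
Complete G = ∀ u v → u ≢ v → Adj G u v

K₁ : Graph 1
K₁ = record { adj = λ _ _ → false ; sym = λ _ _ → refl ; irrefl = λ _ → refl }

private
  jadj : ∀ {n m} → Graph n → Graph m → Fin n ⊎ Fin m → Fin n ⊎ Fin m → Bool
  jadj G H (inj₁ a) (inj₁ b) = adj G a b
  jadj G H (inj₂ a) (inj₂ b) = adj H a b
  jadj G H (inj₁ _) (inj₂ _) = true
  jadj G H (inj₂ _) (inj₁ _) = true

  jsym : ∀ {n m} (G : Graph n) (H : Graph m) a b → jadj G H a b ≡ jadj G H b a
  jsym G H (inj₁ a) (inj₁ b) = sym G a b
  jsym G H (inj₂ a) (inj₂ b) = sym H a b
  jsym G H (inj₁ _) (inj₂ _) = refl
  jsym G H (inj₂ _) (inj₁ _) = refl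

  jirr : ∀ {n m} (G : Graph n) (H : Graph m) a → jadj G H a a ≡ false
  jirr G H (inj₁ a) = irrefl G a
  jirr G H (inj₂ a) = irrefl H a

-- G ∨ H : vertices of G are Fin n ↑ˡ m, vertices of H are n ↑ʳ Fin m
_∨ᴳ_ : ∀ {n m} → Graph n → Graph m → Graph (n Data.Nat.+ m)
_∨ᴳ_ {n} G H = record
  { adj    = λ u v → jadj G H (splitAt n u) (splitAt n v)
  ; sym    = λ u v → jsym G H (splitAt n u) (splitAt n v)
  ; irrefl = λ u → jirr G H (splitAt n u) }

IsClique : ∀ {n} → Graph n → Subset n → Set
IsClique G S = ∀ u v → u ∈ S → v ∈ S → u ≢ v → Adj G u v

IsCliqueNumber : ∀ {n} → Graph n → ℕ → Set
IsCliqueNumber G w =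
  (∃[ S ] (IsClique G S × ∣ S ∣ ≡ w)) × (∀ S → IsClique G S → ∣ S ∣ ≤ w)

data Walk {n} (G : Graph n) : Fin n → Fin n → ℕ → Set where
  here : ∀ {x} → Walk G x x zero
  step : ∀ {x y z k} → Adj G x y → Walk G y z k → Walk G x z (suc k)

data _OnWalk_ {n} {G : Graph n} (v : Fin n) : ∀ {x y k} → Walk G x y k → Set where
  on-here  : ∀ {z k} {p : Walk G v z k} → v OnWalk p
  on-there : ∀ {x y z k} {e : Adj G x y} {p : Walk G y z k} → v OnWalk p → v OnWalk (step e p)

IsShortest : ∀ {n} {G : Graph n} {x y k} → Walk G x y k → Set
IsShortest {G = G} {x} {y} {k} _ = ∀ k' → Walk G x y k' → k ≤ k'

OnCommonGeodesic : ∀ {n} → Graph n → Fin n → Fin n → Fin n → Set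
OnCommonGeodesic G u v w =
  ∃[ x ] ∃[ y ] ∃[ k ] Σ (Walk G x y k) λ p →
    IsShortest p × u OnWalk p × v OnWalk p × w OnWalk p

IsGeneralPosition : ∀ {n} → Graph n → Subset n → Set
IsGeneralPosition G S =
  ∀ u v w → u ∈ S → v ∈ S → w ∈ S → u ≢ v → v ≢ w → u ≢ w →
  ¬ OnCommonGeodesic G u v w

moveSet : ∀ {n} → Subset n → Fin n → Fin n → Subset n
moveSet S u v = (S [ u ]≔ outside) [ v ]≔ inside

LegalMove : ∀ {n} → Graph n → Subset n → Subset n → Set
LegalMove G S S' = ∃[ u ] ∃[ v ]
  (u ∈ S × Adj G u v × v ∉ S × IsGeneralPosition G (moveSet S u v) × S' ≡ moveSet S u v)

-- MoveSeq G S V : a finite sequence of legal moves starting from S;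
-- V is the set of vertices occupied at some moment of the sequence.
data MoveSeq {n} (G : Graph n) : Subset n → Subset n → Set where
  stop : ∀ {S} → MoveSeq G S S
  move : ∀ {S S' V} → LegalMove G S S' → MoveSeq G S' V → MoveSeq G S (S ∪ V)

IsMobileGP : ∀ {n} → Graph n → Subset n → Set
IsMobileGP G S = IsGeneralPosition G S × ∃[ V ] (MoveSeq G S V × (∀ x → x ∈ V))

MobAtLeast : ∀ {n} → Graph n → ℕ → Set
MobAtLeast G k = ∃[ S ] (IsMobileGP G S × k ≤ ∣ S ∣)

MobAtMost : ∀ {n} → Graph n → ℕ → Set
MobAtMost G k = ∀ S → IsMobileGP G S → ∣ S ∣ ≤ k

-- In a join G ∨ H any two vertices are at distance at most 2, so a set is in general position
-- exactly when it induces no P₃; in particular cliques are, and a general position set meeting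
-- both sides is a clique, hence has at most ω(G) + ω(H) vertices.
--
-- Lower bound: take cliques A of G and B of H of size k = min(ω(G), ω(H)).  All (k + 1)-subsets
-- of the clique A ∪ B are mutually reachable, and from them a robot reaches any other vertex x
-- of G, by replacing a neighbour of x in A (giving a clique) or, if x has none, by stepping from
-- B onto x with A occupied (giving a clique plus an isolated vertex); symmetrically for H.  Moves
-- are reversible, so a single sequence of moves visits every vertex.
--
-- Upper bound: a configuration X of at least ω(G) + ω(H) robots meeting both sides is frozen: for
-- a move u → v, both X and the new configuration are cliques, so X ∪ {v} would be a larger clique.
-- Hence it is mobile only if it occupies everything, i.e. G and H are complete.  A configuration on
-- one side stays there: right after the first robot crosses, at most ω + 1 robots, fewer than
-- ω(G) + ω(H), would be in general position.  In G ∨ K₁ a configuration occupying the apex is a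
-- clique of G plus the apex, while the apex and one more vertex form a mobile pair.

module Submission where

open import Defs
open import Data.Nat using (ℕ; zero; suc; _≤_; _+_; _∸_; _⊓_; z≤n; s≤s)
open import Data.Nat.Properties
  using (module ≤-Reasoning; ≤-refl; ≤-reflexive; ≤-trans; <-irrefl; <⇒≱; <⇒≤pred; ≰⇒>;
         +-suc; +-comm; +-identityʳ; +-mono-≤; +-monoˡ-≤; +-monoʳ-≤; +-cancelˡ-≤; +-cancelʳ-≤;
         m⊓n≤m; m⊓n≤n; ⊓-glb)
open import Data.Bool using (true; false; T)
open import Data.Fin using (Fin; zero; suc; _↑ˡ_; _↑ʳ_; splitAt)
open import Data.Fin.Properties
  using (_≟_; any?; ↑ˡ-injective; ↑ʳ-injective; splitAt-↑ˡ; splitAt-↑ʳ; splitAt⁻¹-↑ˡ; splitAt⁻¹-↑ʳ)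
open import Data.Fin.Subset
  using (Subset; ⊤; ⊥; _∈_; _∉_; _⊆_; _⊂_; _∪_; _∩_; ∣_∣; ⁅_⁆; inside; outside; Nonempty; Empty)
open import Data.Fin.Subset.Properties
  using (_∈?_; nonempty?; ∈⊤; ⊆⊤; ∉⊥; ⊥⊆; ∣⊥∣≡0; ∣⊤∣≡n; ∣p∣≤∣x∷p∣; in⊆in; out⊆; drop-not-there;
         x∈⁅x⁆; x∈⁅y⁆⇒x≡y; x∉⁅y⁆⇒x≢y; x≢y⇒x∉⁅y⁆; ∣⁅x⁆∣≡1; ⊆-antisym; ⊆-trans;
         p⊆q⇒∣p∣≤∣q∣; p⊂q⇒∣p∣<∣q∣; x∈p∪q⁺; x∈p∪q⁻; p⊆p∪q; q⊆p∪q; ∪-identityˡ; ∪-comm;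
         x∈p∩q⁺; x∈p∩q⁻; p∩q⊆p; p∩q⊆q; ∣p∩q∣≤∣q∣)
open import Data.Fin.Subset.Induction using (Acc; acc; ⊂-wellFounded)
open import Data.Vec using ([]; _∷_; _++_; here; there; _[_]≔_)
import Data.Vec
open import Data.Vec.Properties
  using ([]=⇒lookup; lookup⇒[]=; []=-injective; []≔-updates; []≔-minimal; lookup∘update′)
open import Data.List using (List; []; _∷_; allFin)
open import Data.List.Relation.Unary.Any using (here; there)
open import Data.List.Membership.Propositional using () renaming (_∈_ to _∈ₗ_)
open import Data.List.Membership.Propositional.Properties using (∈-allFin)
open import Relation.Binary.Construct.Closure.ReflexiveTransitive using (Star; ε; _◅_; _◅◅_)
open import Data.Sum using (_⊎_; inj₁; inj₂)
import Data.Sum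
open import Data.Product using (∃-syntax; _×_; _,_; proj₁; proj₂)
open import Data.Empty using (⊥-elim)
open import Data.Unit using (tt)
open import Function using (_∘_; case_of_)
open import Relation.Binary.PropositionalEquality as ≡ using (_≡_; _≢_; refl; cong; cong₂; subst)
open import Relation.Nullary using (¬_; Dec; yes; no)
open import Relation.Nullary.Decidable using (_×-dec_; ¬?; decidable-stable; T?)

⊆-or-∉ : ∀ {n} (p q : Subset n) → p ⊆ q ⊎ ∃[ x ] (x ∈ p × x ∉ q)
⊆-or-∉ p q with any? (λ x → x ∈? p ×-dec ¬? (x ∈? q))
... | yes witness = inj₂ witness
... | no ∄x       = inj₁ λ {x} x∈p → decidable-stable (x ∈? q) (λ x∉q → ∄x (x , x∈p , x∉q))

p⊆q∧∣q∣≤∣p∣⇒q⊆p : ∀ {n} {p q : Subset n} → p ⊆ q → ∣ q ∣ ≤ ∣ p ∣ → q ⊆ p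
p⊆q∧∣q∣≤∣p∣⇒q⊆p {p = p} {q} p⊆q ∣q∣≤∣p∣ with ⊆-or-∉ q p
... | inj₁ q⊆p             = q⊆p
... | inj₂ (x , x∈q , x∉p) = ⊥-elim (<⇒≱ (p⊂q⇒∣p∣<∣q∣ (p⊆q , x , x∈q , x∉p)) ∣q∣≤∣p∣)

1≤∣p∣⇒Nonempty : ∀ {n} (p : Subset n) → 1 ≤ ∣ p ∣ → Nonempty p
1≤∣p∣⇒Nonempty (true ∷ p)  _ = zero , here
1≤∣p∣⇒Nonempty (false ∷ p) 1≤∣p∣ with 1≤∣p∣⇒Nonempty p 1≤∣p∣
... | x , x∈p = suc x , there x∈p

2≤∣p∣⇒∃≢ : ∀ {n} {p : Subset n} → 2 ≤ ∣ p ∣ → ∀ u → ∃[ x ] (x ∈ p × x ≢ u)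
2≤∣p∣⇒∃≢ {p = p} 2≤∣p∣ u with ⊆-or-∉ p ⁅ u ⁆
... | inj₂ (x , x∈p , x∉⁅u⁆) = x , x∈p , x∉⁅y⁆⇒x≢y x∉⁅u⁆
... | inj₁ p⊆⁅u⁆ with ≤-trans 2≤∣p∣ (≤-trans (p⊆q⇒∣p∣≤∣q∣ p⊆⁅u⁆) (≤-reflexive (∣⁅x⁆∣≡1 u)))
...   | s≤s ()

∃⊆-of-size : ∀ {n} (p : Subset n) {k} → k ≤ ∣ p ∣ → ∃[ q ] (q ⊆ p × ∣ q ∣ ≡ k)
∃⊆-of-size {n} p {zero} _ = ⊥ , ⊥⊆ , ∣⊥∣≡0 n
∃⊆-of-size (true ∷ p) {suc k} (s≤s k≤∣p∣) with ∃⊆-of-size p k≤∣p∣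
... | q , q⊆p , ∣q∣≡k = true ∷ q , in⊆in q⊆p , cong suc ∣q∣≡k
∃⊆-of-size (false ∷ p) {suc k} k<∣p∣ with ∃⊆-of-size p k<∣p∣
... | q , q⊆p , ∣q∣≡k = false ∷ q , out⊆ q⊆p , ∣q∣≡k

∣p∪q∣≤∣p∣+∣q∣ : ∀ {n} (p q : Subset n) → ∣ p ∪ q ∣ ≤ ∣ p ∣ + ∣ q ∣
∣p∪q∣≤∣p∣+∣q∣ []          []          = z≤n
∣p∪q∣≤∣p∣+∣q∣ (true ∷ p)  (b ∷ q)     =
  s≤s (≤-trans (∣p∪q∣≤∣p∣+∣q∣ p q) (+-monoʳ-≤ ∣ p ∣ (∣p∣≤∣x∷p∣ b q)))
∣p∪q∣≤∣p∣+∣q∣ (false ∷ p) (true ∷ q)  =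
  ≤-trans (s≤s (∣p∪q∣≤∣p∣+∣q∣ p q)) (≤-reflexive (≡.sym (+-suc ∣ p ∣ ∣ q ∣)))
∣p∪q∣≤∣p∣+∣q∣ (false ∷ p) (false ∷ q) = ∣p∪q∣≤∣p∣+∣q∣ p q

∣⁅x⁆∪p∣≡1+∣p∣ : ∀ {n} {x : Fin n} (p : Subset n) → x ∉ p → ∣ ⁅ x ⁆ ∪ p ∣ ≡ suc ∣ p ∣
∣⁅x⁆∪p∣≡1+∣p∣ {x = zero}  (true ∷ p)  x∉p = ⊥-elim (x∉p here)
∣⁅x⁆∪p∣≡1+∣p∣ {x = zero}  (false ∷ p) _   = cong (λ r → suc ∣ r ∣) (∪-identityˡ p)
∣⁅x⁆∪p∣≡1+∣p∣ {x = suc x} (true ∷ p)  x∉p = cong suc (∣⁅x⁆∪p∣≡1+∣p∣ p (drop-not-there x∉p))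
∣⁅x⁆∪p∣≡1+∣p∣ {x = suc x} (false ∷ p) x∉p = ∣⁅x⁆∪p∣≡1+∣p∣ p (drop-not-there x∉p)

∈⁅x⁆∪⁻ : ∀ {n} {x y : Fin n} (p : Subset n) → y ∈ ⁅ x ⁆ ∪ p → y ≡ x ⊎ y ∈ p
∈⁅x⁆∪⁻ {x = x} p y∈ with x∈p∪q⁻ ⁅ x ⁆ p y∈
... | inj₁ y∈⁅x⁆ = inj₁ (x∈⁅y⁆⇒x≡y x y∈⁅x⁆)
... | inj₂ y∈p   = inj₂ y∈p

⁅x⁆∪p⊆q : ∀ {n} {x : Fin n} {p q : Subset n} → x ∈ q → p ⊆ q → ⁅ x ⁆ ∪ p ⊆ q
⁅x⁆∪p⊆q {p = p} x∈q p⊆q y∈ with ∈⁅x⁆∪⁻ p y∈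
... | inj₁ refl = x∈q
... | inj₂ y∈p  = p⊆q y∈p

⁅x⁆⊆p : ∀ {n} {x : Fin n} {p : Subset n} → x ∈ p → ⁅ x ⁆ ⊆ p
⁅x⁆⊆p {x = x} x∈p y∈⁅x⁆ = subst (_∈ _) (≡.sym (x∈⁅y⁆⇒x≡y x y∈⁅x⁆)) x∈p

∣⁅x⁆∪⁅y⁆∣≤2 : ∀ {n} (x y : Fin n) → ∣ ⁅ x ⁆ ∪ ⁅ y ⁆ ∣ ≤ 2
∣⁅x⁆∪⁅y⁆∣≤2 x y =
  ≤-trans (∣p∪q∣≤∣p∣+∣q∣ ⁅ x ⁆ ⁅ y ⁆) (+-mono-≤ (≤-reflexive (∣⁅x⁆∣≡1 x)) (≤-reflexive (∣⁅x⁆∣≡1 y)))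

∣⁅u⁆∪⁅v⁆∪⁅w⁆∣≡3 : ∀ {n} {u v w : Fin n} → u ≢ v → v ≢ w → u ≢ w → ∣ ⁅ u ⁆ ∪ ⁅ v ⁆ ∪ ⁅ w ⁆ ∣ ≡ 3
∣⁅u⁆∪⁅v⁆∪⁅w⁆∣≡3 {u = u} {v} {w} u≢v v≢w u≢w = begin
  ∣ ⁅ u ⁆ ∪ ⁅ v ⁆ ∪ ⁅ w ⁆ ∣  ≡⟨ ∣⁅x⁆∪p∣≡1+∣p∣ (⁅ v ⁆ ∪ ⁅ w ⁆) u∉ ⟩
  suc ∣ ⁅ v ⁆ ∪ ⁅ w ⁆ ∣      ≡⟨ cong suc (∣⁅x⁆∪p∣≡1+∣p∣ ⁅ w ⁆ (x≢y⇒x∉⁅y⁆ v≢w)) ⟩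
  suc (suc ∣ ⁅ w ⁆ ∣)        ≡⟨ cong (λ k → suc (suc k)) (∣⁅x⁆∣≡1 w) ⟩
  3                          ∎
  where
  open ≡.≡-Reasoning
  u∉ : u ∉ ⁅ v ⁆ ∪ ⁅ w ⁆
  u∉ u∈ with ∈⁅x⁆∪⁻ ⁅ w ⁆ u∈
  ... | inj₁ u≡v   = u≢v u≡v
  ... | inj₂ u∈⁅w⁆ = u≢w (x∈⁅y⁆⇒x≡y w u∈⁅w⁆)

∈-[]≔⁻ : ∀ {n} {p : Subset n} {x i b} → x ≢ i → x ∈ p [ i ]≔ b → x ∈ p
∈-[]≔⁻ {p = p} {x} x≢i x∈p′ =
  lookup⇒[]= x p (≡.trans (≡.sym (lookup∘update′ x≢i p _)) ([]=⇒lookup x∈p′))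

suc∣p[x]≔outside∣≡∣p∣ : ∀ {n} (p : Subset n) {x} → x ∈ p → suc ∣ p [ x ]≔ outside ∣ ≡ ∣ p ∣
suc∣p[x]≔outside∣≡∣p∣ (true ∷ p)  here        = refl
suc∣p[x]≔outside∣≡∣p∣ (true ∷ p)  (there x∈p) = cong suc (suc∣p[x]≔outside∣≡∣p∣ p x∈p)
suc∣p[x]≔outside∣≡∣p∣ (false ∷ p) (there x∈p) = suc∣p[x]≔outside∣≡∣p∣ p x∈p

∣p[x]≔inside∣≡suc∣p∣ : ∀ {n} (p : Subset n) {x} → x ∉ p → ∣ p [ x ]≔ inside ∣ ≡ suc ∣ p ∣
∣p[x]≔inside∣≡suc∣p∣ (true ∷ p)  {zero}  x∉p = ⊥-elim (x∉p here)
∣p[x]≔inside∣≡suc∣p∣ (false ∷ p) {zero}  _   = refl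
∣p[x]≔inside∣≡suc∣p∣ (true ∷ p)  {suc x} x∉p = cong suc (∣p[x]≔inside∣≡suc∣p∣ p (drop-not-there x∉p))
∣p[x]≔inside∣≡suc∣p∣ (false ∷ p) {suc x} x∉p = ∣p[x]≔inside∣≡suc∣p∣ p (drop-not-there x∉p)

module _ {n : ℕ} (S : Subset n) (u v : Fin n) where

  ∈-moveSet-target : v ∈ moveSet S u v
  ∈-moveSet-target = []≔-updates (S [ u ]≔ outside) v

  ∈-moveSet⁺ : ∀ {x} → x ∈ S → x ≢ u → x ∈ moveSet S u v
  ∈-moveSet⁺ {x} x∈S x≢u with x ≟ v
  ... | yes refl = ∈-moveSet-target
  ... | no x≢v   = []≔-minimal _ x v x≢v ([]≔-minimal S x u x≢u x∈S)

  ∈-moveSet⁻ : ∀ {x} → x ∈ moveSet S u v → x ≡ v ⊎ (x ≢ u × x ∈ S)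
  ∈-moveSet⁻ {x} x∈S′ with x ≟ v | x ≟ u
  ... | yes x≡v | _      = inj₁ x≡v
  ... | no x≢v  | no x≢u = inj₂ (x≢u , ∈-[]≔⁻ x≢u (∈-[]≔⁻ x≢v x∈S′))
  ... | no x≢v  | yes refl with []=-injective ([]≔-updates S x) (∈-[]≔⁻ x≢v x∈S′)
  ...   | ()

  ∉-moveSet-source : u ≢ v → u ∉ moveSet S u v
  ∉-moveSet-source u≢v u∈S′ with ∈-moveSet⁻ u∈S′
  ... | inj₁ u≡v       = u≢v u≡v
  ... | inj₂ (u≢u , _) = u≢u refl

module _ {n : ℕ} {S : Subset n} {u v : Fin n} (u∈S : u ∈ S) (v∉S : v ∉ S) where

  moveSet-back : moveSet (moveSet S u v) v u ≡ S
  moveSet-back = ⊆-antisym back⊆S S⊆back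
    where
    back⊆S : moveSet (moveSet S u v) v u ⊆ S
    back⊆S x∈ with ∈-moveSet⁻ (moveSet S u v) v u x∈
    ... | inj₁ refl = u∈S
    ... | inj₂ (x≢v , x∈S′) with ∈-moveSet⁻ S u v x∈S′
    ...   | inj₁ x≡v       = ⊥-elim (x≢v x≡v)
    ...   | inj₂ (_ , x∈S) = x∈S
    S⊆back : S ⊆ moveSet (moveSet S u v) v u
    S⊆back {x} x∈S with x ≟ u
    ... | yes refl = ∈-moveSet-target (moveSet S u v) v u
    ... | no x≢u   = ∈-moveSet⁺ (moveSet S u v) v u (∈-moveSet⁺ S u v x∈S x≢u) (λ { refl → v∉S x∈S })

  ∣moveSet∣≡∣S∣ : ∣ moveSet S u v ∣ ≡ ∣ S ∣
  ∣moveSet∣≡∣S∣ = ≡.trans (∣p[x]≔inside∣≡suc∣p∣ (S [ u ]≔ outside) v∉S′) (suc∣p[x]≔outside∣≡∣p∣ S u∈S)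
    where
    v∉S′ : v ∉ S [ u ]≔ outside
    v∉S′ v∈S′ = v∉S (∈-[]≔⁻ (λ { refl → v∉S u∈S }) v∈S′)

moveSet-⊆ : ∀ {n} {X K : Subset n} {u v} → X ⊆ K → v ∈ K → moveSet X u v ⊆ K
moveSet-⊆ {X = X} {u = u} {v} X⊆K v∈K x∈ with ∈-moveSet⁻ X u v x∈
... | inj₁ refl      = v∈K
... | inj₂ (_ , x∈X) = X⊆K x∈X

moveSet-⁅⁆∪-⊆ : ∀ {n} {u v : Fin n} (T : Subset n) → moveSet (⁅ u ⁆ ∪ T) u v ⊆ ⁅ v ⁆ ∪ T
moveSet-⁅⁆∪-⊆ {u = u} {v} T x∈ with ∈-moveSet⁻ (⁅ u ⁆ ∪ T) u v x∈
... | inj₁ refl = x∈p∪q⁺ (inj₁ (x∈⁅x⁆ v))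
... | inj₂ (x≢u , x∈⁅u⁆∪T) with ∈⁅x⁆∪⁻ T x∈⁅u⁆∪T
...   | inj₁ x≡u = ⊥-elim (x≢u x≡u)
...   | inj₂ x∈T = x∈p∪q⁺ (inj₂ x∈T)

moveSet-∪⊂ : ∀ {n} {X Y : Subset n} {u v} → u ∈ X → u ∉ Y → v ∈ Y → v ∉ X → moveSet X u v ∪ Y ⊂ X ∪ Y
moveSet-∪⊂ {X = X} {Y} {u} {v} u∈X u∉Y v∈Y v∉X = X′∪Y⊆X∪Y , u , x∈p∪q⁺ (inj₁ u∈X) , u∉X′∪Y
  where
  X′∪Y⊆X∪Y : moveSet X u v ∪ Y ⊆ X ∪ Y
  X′∪Y⊆X∪Y x∈ with x∈p∪q⁻ (moveSet X u v) Y x∈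
  ... | inj₂ x∈Y = x∈p∪q⁺ (inj₂ x∈Y)
  ... | inj₁ x∈X′ with ∈-moveSet⁻ X u v x∈X′
  ...   | inj₁ refl      = x∈p∪q⁺ (inj₂ v∈Y)
  ...   | inj₂ (_ , x∈X) = x∈p∪q⁺ (inj₁ x∈X)
  u∉X′∪Y : u ∉ moveSet X u v ∪ Y
  u∉X′∪Y u∈ with x∈p∪q⁻ (moveSet X u v) Y u∈
  ... | inj₁ u∈X′ = ∉-moveSet-source X u v (λ { refl → v∉X u∈X }) u∈X′
  ... | inj₂ u∈Y  = u∉Y u∈Y

moveSet-meets : ∀ {n} {X P : Subset n} {u v} → 2 ≤ ∣ X ∩ P ∣ → Nonempty (moveSet X u v ∩ P)
moveSet-meets {X = X} {P} {u} {v} 2≤∣X∩P∣ with 2≤∣p∣⇒∃≢ 2≤∣X∩P∣ u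
... | x , x∈X∩P , x≢u with x∈p∩q⁻ X P x∈X∩P
...   | x∈X , x∈P = x , x∈p∩q⁺ (∈-moveSet⁺ X u v x∈X x≢u , x∈P)

module _ {n : ℕ} (Γ : Graph n) where

  -- Geodesics and general position

  Adj-sym : ∀ {x y} → Adj Γ x y → Adj Γ y x
  Adj-sym {x} {y} = subst T (sym Γ x y)

  Adj-irrefl : ∀ {x} → ¬ Adj Γ x x
  Adj-irrefl {x} = subst T (irrefl Γ x)

  Adj⇒≢ : ∀ {x y} → Adj Γ x y → x ≢ y
  Adj⇒≢ x~y refl = Adj-irrefl x~y

  Walk₀⇒≡ : ∀ {x y} → Walk Γ x y 0 → x ≡ y
  Walk₀⇒≡ here = refl

  Walk₁⇒Adj : ∀ {x y} → Walk Γ x y 1 → Adj Γ x y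
  Walk₁⇒Adj (step x~y here) = x~y

  IsShortest⇒≢ : ∀ {x y k} {p : Walk Γ x y (suc k)} → IsShortest p → x ≢ y
  IsShortest⇒≢ shortest refl with shortest 0 here
  ... | ()

  IsShortest⇒¬Adj : ∀ {x y k} {p : Walk Γ x y (suc (suc k))} → IsShortest p → ¬ Adj Γ x y
  IsShortest⇒¬Adj shortest x~y with shortest 1 (step x~y here)
  ... | s≤s ()

  induced-P₃-IsShortest : ∀ {a b c} (a~b : Adj Γ a b) (b~c : Adj Γ b c) → ¬ Adj Γ a c → a ≢ c →
                          IsShortest (step a~b (step b~c here))
  induced-P₃-IsShortest _ _ _    a≢c zero          p = ⊥-elim (a≢c (Walk₀⇒≡ p))
  induced-P₃-IsShortest _ _ ¬a~c _   (suc zero)    p = ⊥-elim (¬a~c (Walk₁⇒Adj p))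
  induced-P₃-IsShortest _ _ _    _   (suc (suc k)) _ = s≤s (s≤s z≤n)

  vertices : ∀ {x y k} → Walk Γ x y k → Subset n
  vertices {x} here       = ⁅ x ⁆
  vertices {x} (step _ p) = ⁅ x ⁆ ∪ vertices p

  OnWalk⇒∈vertices : ∀ {v x y k} {p : Walk Γ x y k} → v OnWalk p → v ∈ vertices p
  OnWalk⇒∈vertices {v} {p = here}     on-here      = x∈⁅x⁆ v
  OnWalk⇒∈vertices {v} {p = step _ _} on-here      = x∈p∪q⁺ (inj₁ (x∈⁅x⁆ v))
  OnWalk⇒∈vertices                     (on-there o) = x∈p∪q⁺ (inj₂ (OnWalk⇒∈vertices o))

  ∣vertices∣≤1+length : ∀ {x y k} (p : Walk Γ x y k) → ∣ vertices p ∣ ≤ suc k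
  ∣vertices∣≤1+length {x} here       = ≤-reflexive (∣⁅x⁆∣≡1 x)
  ∣vertices∣≤1+length {x} (step _ p) =
    ≤-trans (∣p∪q∣≤∣p∣+∣q∣ ⁅ x ⁆ (vertices p)) (+-mono-≤ (≤-reflexive (∣⁅x⁆∣≡1 x)) (∣vertices∣≤1+length p))

  Diameter≤2 : Set
  Diameter≤2 = ∀ x y → ∃[ k ] (k ≤ 2 × Walk Γ x y k)

  NoInducedP₃ : Subset n → Set
  NoInducedP₃ S = ∀ {a b c} → a ∈ S → b ∈ S → c ∈ S → Adj Γ a b → Adj Γ b c → a ≢ c → Adj Γ a c

  GP⇒NoInducedP₃ : ∀ {S} → IsGeneralPosition Γ S → NoInducedP₃ S
  GP⇒NoInducedP₃ gp {a} {b} {c} a∈S b∈S c∈S a~b b~c a≢c with T? (adj Γ a c)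
  ... | yes a~c = a~c
  ... | no ¬a~c = ⊥-elim (gp a b c a∈S b∈S c∈S (Adj⇒≢ a~b) (Adj⇒≢ b~c) a≢c
                    (a , c , 2 , step a~b (step b~c here) , induced-P₃-IsShortest a~b b~c ¬a~c a≢c ,
                     on-here , on-there on-here , on-there (on-there on-here)))

  NoInducedP₃-∌geodesic₂ : ∀ {S} → NoInducedP₃ S → ∀ {x y k} (p : Walk Γ x y k) →
                           IsShortest p → 2 ≤ k → k ≤ 2 → ¬ vertices p ⊆ S
  NoInducedP₃-∌geodesic₂ noP₃ p@(step x~z (step z~y here)) shortest _ _ p⊆S =
    IsShortest⇒¬Adj {p = p} shortest
      (noP₃ (p⊆S (OnWalk⇒∈vertices {p = p} on-here))
            (p⊆S (OnWalk⇒∈vertices {p = p} (on-there on-here)))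
            (p⊆S (OnWalk⇒∈vertices {p = p} (on-there (on-there on-here))))
            x~z z~y (IsShortest⇒≢ {p = p} shortest))
  NoInducedP₃-∌geodesic₂ _ here                         _ ()       _ _
  NoInducedP₃-∌geodesic₂ _ (step _ here)                _ (s≤s ()) _ _
  NoInducedP₃-∌geodesic₂ _ (step _ (step _ (step _ _))) _ _ (s≤s (s≤s ())) _

  -- Three distinct vertices on a geodesic of length at most 2 make up its whole vertex set.
  NoInducedP₃⇒GP : Diameter≤2 → ∀ {S} → NoInducedP₃ S → IsGeneralPosition Γ S
  NoInducedP₃⇒GP diam {S} noP₃ u v w u∈S v∈S w∈S u≢v v≢w u≢w (x , y , k , p , shortest , u∈p , v∈p , w∈p) =
    NoInducedP₃-∌geodesic₂ noP₃ p shortest 2≤k k≤2 (⊆-trans p⊆uvw uvw⊆S)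
    where
    uvw = ⁅ u ⁆ ∪ ⁅ v ⁆ ∪ ⁅ w ⁆
    ∣uvw∣≡3 = ∣⁅u⁆∪⁅v⁆∪⁅w⁆∣≡3 u≢v v≢w u≢w
    uvw⊆S : uvw ⊆ S
    uvw⊆S = ⁅x⁆∪p⊆q u∈S (⁅x⁆∪p⊆q v∈S (⁅x⁆⊆p w∈S))
    uvw⊆p : uvw ⊆ vertices p
    uvw⊆p = ⁅x⁆∪p⊆q (OnWalk⇒∈vertices u∈p) (⁅x⁆∪p⊆q (OnWalk⇒∈vertices v∈p) (⁅x⁆⊆p (OnWalk⇒∈vertices w∈p)))
    k≤2 : k ≤ 2
    k≤2 with diam x y
    ... | j , j≤2 , q = ≤-trans (shortest j q) j≤2
    2≤k : 2 ≤ k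
    2≤k with ≤-trans (≤-reflexive (≡.sym ∣uvw∣≡3)) (≤-trans (p⊆q⇒∣p∣≤∣q∣ uvw⊆p) (∣vertices∣≤1+length p))
    ... | s≤s 2≤k = 2≤k
    p⊆uvw : vertices p ⊆ uvw
    p⊆uvw = p⊆q∧∣q∣≤∣p∣⇒q⊆p uvw⊆p
              (≤-trans (∣vertices∣≤1+length p) (≤-trans (s≤s k≤2) (≤-reflexive (≡.sym ∣uvw∣≡3))))

  ∣S∣≤2⇒GP : ∀ {S} → ∣ S ∣ ≤ 2 → IsGeneralPosition Γ S
  ∣S∣≤2⇒GP ∣S∣≤2 u v w u∈S v∈S w∈S u≢v v≢w u≢w _
    with ≤-trans (≤-reflexive (≡.sym (∣⁅u⁆∪⁅v⁆∪⁅w⁆∣≡3 u≢v v≢w u≢w)))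
                 (≤-trans (p⊆q⇒∣p∣≤∣q∣ (⁅x⁆∪p⊆q u∈S (⁅x⁆∪p⊆q v∈S (⁅x⁆⊆p w∈S)))) ∣S∣≤2)
  ... | s≤s (s≤s ())

  GP-⊆ : ∀ {S T} → S ⊆ T → IsGeneralPosition Γ T → IsGeneralPosition Γ S
  GP-⊆ S⊆T gp u v w u∈S v∈S w∈S = gp u v w (S⊆T u∈S) (S⊆T v∈S) (S⊆T w∈S)

  IsClique-⊆ : ∀ {S T} → S ⊆ T → IsClique Γ T → IsClique Γ S
  IsClique-⊆ S⊆T clique u v u∈S v∈S = clique u v (S⊆T u∈S) (S⊆T v∈S)

  clique⇒NoInducedP₃ : ∀ {S} → IsClique Γ S → NoInducedP₃ S
  clique⇒NoInducedP₃ clique a∈S _ c∈S _ _ = clique _ _ a∈S c∈S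

  clique⇒GP : Diameter≤2 → ∀ {S} → IsClique Γ S → IsGeneralPosition Γ S
  clique⇒GP diam clique = NoInducedP₃⇒GP diam (clique⇒NoInducedP₃ clique)

  clique-⁅⁆∪ : ∀ {x T} → IsClique Γ T → (∀ {y} → y ∈ T → y ≢ x → Adj Γ x y) → IsClique Γ (⁅ x ⁆ ∪ T)
  clique-⁅⁆∪ {T = T} clique x~T a b a∈ b∈ a≢b with ∈⁅x⁆∪⁻ T a∈ | ∈⁅x⁆∪⁻ T b∈
  ... | inj₁ refl | inj₁ refl = ⊥-elim (a≢b refl)
  ... | inj₁ refl | inj₂ b∈T  = x~T b∈T (a≢b ∘ ≡.sym)
  ... | inj₂ a∈T  | inj₁ refl = Adj-sym (x~T a∈T a≢b)
  ... | inj₂ a∈T  | inj₂ b∈T  = clique a b a∈T b∈T a≢b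

  NoInducedP₃-⁅⁆∪ : ∀ {x T} → NoInducedP₃ T → (∀ {y} → y ∈ T → ¬ Adj Γ x y) → NoInducedP₃ (⁅ x ⁆ ∪ T)
  NoInducedP₃-⁅⁆∪ {T = T} noP₃ x≁T a∈ b∈ c∈ a~b b~c a≢c with ∈⁅x⁆∪⁻ T a∈ | ∈⁅x⁆∪⁻ T b∈ | ∈⁅x⁆∪⁻ T c∈
  ... | inj₁ refl | inj₁ refl | _         = ⊥-elim (Adj-irrefl a~b)
  ... | inj₂ a∈T  | inj₁ refl | _         = ⊥-elim (x≁T a∈T (Adj-sym a~b))
  ... | inj₁ refl | inj₂ b∈T  | _         = ⊥-elim (x≁T b∈T a~b)
  ... | inj₂ _    | inj₂ b∈T  | inj₁ refl = ⊥-elim (x≁T b∈T (Adj-sym b~c))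
  ... | inj₂ a∈T  | inj₂ b∈T  | inj₂ c∈T  = noP₃ a∈T b∈T c∈T a~b b~c a≢c

  -- Reachability and mobility

  Reach : Subset n → Subset n → Set
  Reach = Star (LegalMove Γ)

  LegalMove⇒GP : ∀ {S S′} → LegalMove Γ S S′ → IsGeneralPosition Γ S′
  LegalMove⇒GP (_ , _ , _ , _ , _ , gp , refl) = gp

  LegalMove⇒∣∣≡ : ∀ {S S′} → LegalMove Γ S S′ → ∣ S′ ∣ ≡ ∣ S ∣
  LegalMove⇒∣∣≡ (_ , _ , u∈S , _ , v∉S , _ , refl) = ∣moveSet∣≡∣S∣ u∈S v∉S

  LegalMove-sym : ∀ {S S′} → IsGeneralPosition Γ S → LegalMove Γ S S′ → LegalMove Γ S′ S
  LegalMove-sym {S} gp (u , v , u∈S , u~v , v∉S , _ , refl) =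
    v , u , ∈-moveSet-target S u v , Adj-sym u~v , ∉-moveSet-source S u v (Adj⇒≢ u~v) ,
    subst (IsGeneralPosition Γ) (≡.sym back) gp , ≡.sym back
    where back = moveSet-back u∈S v∉S

  Reach-reverse : ∀ {S X} → IsGeneralPosition Γ S → Reach S X → Reach X S
  Reach-reverse gp ε        = ε
  Reach-reverse gp (m ◅ ms) = Reach-reverse (LegalMove⇒GP m) ms ◅◅ (LegalMove-sym gp m ◅ ε)

  Reach-invariant : (I : Subset n → Set) → (∀ {X Y} → I X → LegalMove Γ X Y → I Y) →
                    ∀ {S X} → I S → Reach S X → I X
  Reach-invariant I preserved i ε        = i
  Reach-invariant I preserved i (m ◅ ms) = Reach-invariant I preserved (preserved i m) ms

  Reach⇒GP : ∀ {S X} → IsGeneralPosition Γ S → Reach S X → IsGeneralPosition Γ X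
  Reach⇒GP = Reach-invariant (IsGeneralPosition Γ) (λ _ m → LegalMove⇒GP m)

  Reach⇒∣∣≡ : ∀ {S X} → Reach S X → ∣ X ∣ ≡ ∣ S ∣
  Reach⇒∣∣≡ {S} = Reach-invariant (λ X → ∣ X ∣ ≡ ∣ S ∣) (λ eq m → ≡.trans (LegalMove⇒∣∣≡ m) eq) refl

  Visits : Subset n → Fin n → Set
  Visits S x = ∃[ X ] (Reach S X × x ∈ X)

  Visits-◅◅ : ∀ {S T x} → Reach S T → Visits T x → Visits S x
  Visits-◅◅ S→T (X , T→X , x∈X) = X , S→T ◅◅ T→X , x∈X

  frozen-Visits⇒∈ : ∀ {S x} → (∀ {Y} → ¬ LegalMove Γ S Y) → Visits S x → x ∈ S
  frozen-Visits⇒∈ frozen (_ , ε     , x∈S) = x∈S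
  frozen-Visits⇒∈ frozen (_ , m ◅ _ , _)   = ⊥-elim (frozen m)

  Visits-replace : ∀ {u v T} → Adj Γ u v → v ∉ ⁅ u ⁆ ∪ T → IsGeneralPosition Γ (⁅ v ⁆ ∪ T) →
                   Visits (⁅ u ⁆ ∪ T) v
  Visits-replace {u} {v} {T} u~v v∉ gp =
    moveSet (⁅ u ⁆ ∪ T) u v ,
    (u , v , x∈p∪q⁺ (inj₁ (x∈⁅x⁆ u)) , u~v , v∉ , GP-⊆ (moveSet-⁅⁆∪-⊆ T) gp , refl) ◅ ε ,
    ∈-moveSet-target (⁅ u ⁆ ∪ T) u v

  MoveSeq-start : ∀ {S V} → MoveSeq Γ S V → S ⊆ V
  MoveSeq-start stop       x∈S = x∈S
  MoveSeq-start (move _ _) x∈S = x∈p∪q⁺ (inj₁ x∈S)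

  MoveSeq⇒Visits : ∀ {S V x} → MoveSeq Γ S V → x ∈ V → Visits S x
  MoveSeq⇒Visits stop x∈S = _ , ε , x∈S
  MoveSeq⇒Visits (move {S = S} {V = V} m seq) x∈ with x∈p∪q⁻ S V x∈
  ... | inj₁ x∈S = S , ε , x∈S
  ... | inj₂ x∈V = Visits-◅◅ (m ◅ ε) (MoveSeq⇒Visits seq x∈V)

  Reach-◅-MoveSeq : ∀ {S T V} → Reach S T → MoveSeq Γ T V → ∃[ W ] (MoveSeq Γ S W × V ⊆ W)
  Reach-◅-MoveSeq ε        seq = _ , seq , λ x∈V → x∈V
  Reach-◅-MoveSeq (m ◅ ms) seq with Reach-◅-MoveSeq ms seq
  ... | W , seq′ , V⊆W = _ , move m seq′ , λ x∈V → x∈p∪q⁺ (inj₂ (V⊆W x∈V))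

  mobile⇒Visits : ∀ {S} → IsMobileGP Γ S → ∀ x → Visits S x
  mobile⇒Visits (_ , V , seq , all∈V) x = MoveSeq⇒Visits seq (all∈V x)

  Visits⇒mobile : ∀ {S} → IsGeneralPosition Γ S → (∀ x → Visits S x) → IsMobileGP Γ S
  Visits⇒mobile {S} gp visits with tour (allFin n)
    where
    tour : (xs : List (Fin n)) → ∃[ W ] (MoveSeq Γ S W × (∀ {x} → x ∈ₗ xs → x ∈ W))
    tour []       = S , stop , λ ()
    tour (x ∷ xs) with tour xs | visits x
    ... | W , seq , xs⊆W | T , S→T , x∈T with Reach-◅-MoveSeq (Reach-reverse gp S→T) seq
    ...   | W₁ , seq₁ , W⊆W₁ with Reach-◅-MoveSeq S→T seq₁
    ...     | W₂ , seq₂ , W₁⊆W₂ = W₂ , seq₂ , λ where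
      (here refl)  → W₁⊆W₂ (MoveSeq-start seq₁ x∈T)
      (there y∈xs) → W₁⊆W₂ (W⊆W₁ (xs⊆W y∈xs))
  ... | W , seq , all∈W = gp , W , seq , λ x → all∈W (∈-allFin x)

  -- Induction on X ∪ Y, which shrinks when a robot moves from X ∖ Y to Y ∖ X.
  clique-Reach : Diameter≤2 → ∀ {K} → IsClique Γ K → ∀ {X Y} → X ⊆ K → Y ⊆ K → ∣ X ∣ ≡ ∣ Y ∣ → Reach X Y
  clique-Reach diam {K} clique {X} {Y} X⊆K Y⊆K = go (⊂-wellFounded (X ∪ Y)) X⊆K
    where
    go : ∀ {X} → Acc _⊂_ (X ∪ Y) → X ⊆ K → ∣ X ∣ ≡ ∣ Y ∣ → Reach X Y
    go {X} (acc smaller) X⊆K eq with ⊆-or-∉ X Y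
    ... | inj₁ X⊆Y = subst (Reach X) (⊆-antisym X⊆Y (p⊆q∧∣q∣≤∣p∣⇒q⊆p X⊆Y (≤-reflexive (≡.sym eq)))) ε
    ... | inj₂ (u , u∈X , u∉Y) with ⊆-or-∉ Y X
    ...   | inj₁ Y⊆X = ⊥-elim (<-irrefl (≡.sym eq) (p⊂q⇒∣p∣<∣q∣ (Y⊆X , u , u∈X , u∉Y)))
    ...   | inj₂ (v , v∈Y , v∉X) =
      X→X′ ◅ go (smaller (moveSet-∪⊂ u∈X u∉Y v∈Y v∉X)) X′⊆K (≡.trans (∣moveSet∣≡∣S∣ u∈X v∉X) eq)
      where
      X′⊆K = moveSet-⊆ X⊆K (Y⊆K v∈Y)
      X→X′ : LegalMove Γ X (moveSet X u v)
      X→X′ = u , v , u∈X , clique u v (X⊆K u∈X) (Y⊆K v∈Y) (λ { refl → v∉X u∈X }) , v∉X ,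
             clique⇒GP diam (IsClique-⊆ X′⊆K clique) , refl

  universal-vertex⇒mob≥2 : ∀ {c g} → (∀ x → x ≢ c → Adj Γ c x) → g ≢ c → MobAtLeast Γ 2
  universal-vertex⇒mob≥2 {c} {g} c~all g≢c =
    C , Visits⇒mobile (∣S∣≤2⇒GP (≤-reflexive ∣C∣≡2)) visits , ≤-reflexive (≡.sym ∣C∣≡2)
    where
    C = ⁅ c ⁆ ∪ ⁅ g ⁆
    ∣C∣≡2 : ∣ C ∣ ≡ 2
    ∣C∣≡2 = ≡.trans (∣⁅x⁆∪p∣≡1+∣p∣ ⁅ g ⁆ (x≢y⇒x∉⁅y⁆ (g≢c ∘ ≡.sym))) (cong suc (∣⁅x⁆∣≡1 g))
    visits : ∀ x → Visits C x
    visits x with x ∈? C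
    ... | yes x∈C = C , ε , x∈C
    ... | no x∉C  = Visits-replace (c~all x λ { refl → x∉C (x∈p∪q⁺ (inj₁ (x∈⁅x⁆ c))) }) x∉C
                                   (∣S∣≤2⇒GP (∣⁅x⁆∪⁅y⁆∣≤2 x g))

  -- Joins

  -- Arguments about one side of a join are made once and applied to the other side through swap.
  record JoinSplit : Set where
    field
      left right     : Subset n
      left-or-right  : ∀ x → x ∈ left ⊎ x ∈ right
      left-right-adj : ∀ {x y} → x ∈ left → y ∈ right → Adj Γ x y

  open JoinSplit public

  swap : JoinSplit → JoinSplit
  swap J = record
    { left           = right J
    ; right          = left J
    ; left-or-right  = Data.Sum.swap ∘ left-or-right J
    ; left-right-adj = λ x∈R y∈L → Adj-sym (left-right-adj J y∈L x∈R)
    }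

  CliqueBound : Subset n → ℕ → Set
  CliqueBound P ω = ∀ X → IsClique Γ X → X ⊆ P → ∣ X ∣ ≤ ω

  HasClique : Subset n → ℕ → Set
  HasClique P ω = ∃[ A ] (IsClique Γ A × A ⊆ P × ∣ A ∣ ≡ ω)

  HasClique⇒Nonempty : ∀ {P ω} → HasClique P ω → 1 ≤ ω → Nonempty P
  HasClique⇒Nonempty (A , _ , A⊆P , ∣A∣≡ω) 1≤ω with 1≤∣p∣⇒Nonempty A (subst (1 ≤_) (≡.sym ∣A∣≡ω) 1≤ω)
  ... | a , a∈A = a , A⊆P a∈A

  left⇒∉right : (J : JoinSplit) → ∀ {x} → x ∈ left J → x ∉ right J
  left⇒∉right J x∈L x∈R = Adj-irrefl (left-right-adj J x∈L x∈R)

  diameter≤2 : (J : JoinSplit) → Nonempty (left J) → Nonempty (right J) → Diameter≤2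
  diameter≤2 J (p , p∈L) (q , q∈R) x y with left-or-right J x | left-or-right J y
  ... | inj₁ x∈L | inj₁ y∈L =
    2 , ≤-refl , step (left-right-adj J x∈L q∈R) (step (Adj-sym (left-right-adj J y∈L q∈R)) here)
  ... | inj₁ x∈L | inj₂ y∈R = 1 , s≤s z≤n , step (left-right-adj J x∈L y∈R) here
  ... | inj₂ x∈R | inj₁ y∈L = 1 , s≤s z≤n , step (Adj-sym (left-right-adj J y∈L x∈R)) here
  ... | inj₂ x∈R | inj₂ y∈R =
    2 , ≤-refl , step (Adj-sym (left-right-adj J p∈L x∈R)) (step (left-right-adj J p∈L y∈R) here)

  ∣X∣≤∣X∩left∣+∣X∩right∣ : (J : JoinSplit) (X : Subset n) → ∣ X ∣ ≤ ∣ X ∩ left J ∣ + ∣ X ∩ right J ∣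
  ∣X∣≤∣X∩left∣+∣X∩right∣ J X = ≤-trans (p⊆q⇒∣p∣≤∣q∣ X⊆) (∣p∪q∣≤∣p∣+∣q∣ (X ∩ left J) (X ∩ right J))
    where
    X⊆ : X ⊆ (X ∩ left J) ∪ (X ∩ right J)
    X⊆ {x} x∈X with left-or-right J x
    ... | inj₁ x∈L = x∈p∪q⁺ (inj₁ (x∈p∩q⁺ (x∈X , x∈L)))
    ... | inj₂ x∈R = x∈p∪q⁺ (inj₂ (x∈p∩q⁺ (x∈X , x∈R)))

  GP∧meets-right⇒left-clique : (J : JoinSplit) → ∀ {X} → IsGeneralPosition Γ X → Nonempty (X ∩ right J) →
                               IsClique Γ (X ∩ left J)
  GP∧meets-right⇒left-clique J {X} gp (q , q∈X∩R) a b a∈ b∈ a≢b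
    with x∈p∩q⁻ X _ a∈ | x∈p∩q⁻ X _ b∈ | x∈p∩q⁻ X _ q∈X∩R
  ... | a∈X , a∈L | b∈X , b∈L | q∈X , q∈R =
    GP⇒NoInducedP₃ gp a∈X q∈X b∈X (left-right-adj J a∈L q∈R) (Adj-sym (left-right-adj J b∈L q∈R)) a≢b

  mixed-GP⇒clique : (J : JoinSplit) → ∀ {X} → IsGeneralPosition Γ X →
                    Nonempty (X ∩ left J) → Nonempty (X ∩ right J) → IsClique Γ X
  mixed-GP⇒clique J {X} gp meetsL meetsR a b a∈X b∈X a≢b with left-or-right J a | left-or-right J b
  ... | inj₁ a∈L | inj₁ b∈L =
    GP∧meets-right⇒left-clique J gp meetsR a b (x∈p∩q⁺ (a∈X , a∈L)) (x∈p∩q⁺ (b∈X , b∈L)) a≢b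
  ... | inj₁ a∈L | inj₂ b∈R = left-right-adj J a∈L b∈R
  ... | inj₂ a∈R | inj₁ b∈L = Adj-sym (left-right-adj J b∈L a∈R)
  ... | inj₂ a∈R | inj₂ b∈R =
    GP∧meets-right⇒left-clique (swap J) gp meetsL a b (x∈p∩q⁺ (a∈X , a∈R)) (x∈p∩q⁺ (b∈X , b∈R)) a≢b

  clique⇒∣∣≤ωL+ωR : (J : JoinSplit) → ∀ {ωL ωR} → CliqueBound (left J) ωL → CliqueBound (right J) ωR →
                   ∀ {K} → IsClique Γ K → ∣ K ∣ ≤ ωL + ωR
  clique⇒∣∣≤ωL+ωR J boundL boundR {K} clique = ≤-trans (∣X∣≤∣X∩left∣+∣X∩right∣ J K)
    (+-mono-≤ (boundL _ (IsClique-⊆ (p∩q⊆p K _) clique) (p∩q⊆q K _))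
              (boundR _ (IsClique-⊆ (p∩q⊆p K _) clique) (p∩q⊆q K _)))

  GP∧meets-right⇒∣∣≤ : (J : JoinSplit) → ∀ {ω} → CliqueBound (left J) ω → ∀ {X} → IsGeneralPosition Γ X →
                       Nonempty (X ∩ right J) → ∣ X ∣ ≤ ω + ∣ X ∩ right J ∣
  GP∧meets-right⇒∣∣≤ J bound {X} gp meetsR = ≤-trans (∣X∣≤∣X∩left∣+∣X∩right∣ J X)
    (+-monoˡ-≤ _ (bound _ (GP∧meets-right⇒left-clique J gp meetsR) (p∩q⊆q X _)))

  large-clique⇒ωL≤∣∩left∣ : (J : JoinSplit) → ∀ {ωL ωR} → CliqueBound (right J) ωR →
                            ∀ {X} → IsClique Γ X → ωL + ωR ≤ ∣ X ∣ → ωL ≤ ∣ X ∩ left J ∣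
  large-clique⇒ωL≤∣∩left∣ J {ωL} {ωR} boundR {X} clique big = +-cancelʳ-≤ ωR ωL ∣ X ∩ left J ∣
    (≤-trans big (≤-trans (∣X∣≤∣X∩left∣+∣X∩right∣ J X)
      (+-monoʳ-≤ ∣ X ∩ left J ∣ (boundR _ (IsClique-⊆ (p∩q⊆p X _) clique) (p∩q⊆q X _)))))

  large-mixed-frozen : (J : JoinSplit) → ∀ {ωL ωR} → CliqueBound (left J) ωL → CliqueBound (right J) ωR →
                       2 ≤ ωL → 2 ≤ ωR → ∀ {X} → IsGeneralPosition Γ X →
                       Nonempty (X ∩ left J) → Nonempty (X ∩ right J) → ωL + ωR ≤ ∣ X ∣ →
                       ∀ {Y} → ¬ LegalMove Γ X Y
  large-mixed-frozen J {ωL} {ωR} boundL boundR 2≤ωL 2≤ωR {X} gp meetsL meetsR big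
                     (u , v , u∈X , u~v , v∉X , gp′ , refl) =
    <-irrefl refl (≤-trans (s≤s big) (≤-trans (≤-reflexive (≡.sym (∣⁅x⁆∪p∣≡1+∣p∣ X v∉X)))
                                              (clique⇒∣∣≤ωL+ωR J boundL boundR vX-clique)))
    where
    X-clique = mixed-GP⇒clique J gp meetsL meetsR
    X′-clique : IsClique Γ (moveSet X u v)
    X′-clique = mixed-GP⇒clique J gp′
      (moveSet-meets (≤-trans 2≤ωL (large-clique⇒ωL≤∣∩left∣ J boundR X-clique big)))
      (moveSet-meets (≤-trans 2≤ωR (large-clique⇒ωL≤∣∩left∣ (swap J) boundL X-clique
                                     (≤-trans (≤-reflexive (+-comm ωR ωL)) big))))
    v~X : ∀ {y} → y ∈ X → y ≢ v → Adj Γ v y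
    v~X {y} y∈X y≢v with y ≟ u
    ... | yes refl = Adj-sym u~v
    ... | no y≢u   = X′-clique v y (∈-moveSet-target X u v) (∈-moveSet⁺ X u v y∈X y≢u) (y≢v ∘ ≡.sym)
    vX-clique : IsClique Γ (⁅ v ⁆ ∪ X)
    vX-clique = clique-⁅⁆∪ X-clique v~X

  off-right-preserved : (J : JoinSplit) → ∀ {ωL ωR} → CliqueBound (left J) ωL → 2 ≤ ωR →
                        ∀ {X Y} → ωL + ωR ≤ ∣ X ∣ → Empty (X ∩ right J) → LegalMove Γ X Y → Empty (Y ∩ right J)
  off-right-preserved J {ωL} {ωR} boundL 2≤ωR {X} big offR (u , v , u∈X , _ , v∉X , gp′ , refl) meetsR
    with +-cancelˡ-≤ ωL 2 1
           (≤-trans (+-monoʳ-≤ ωL 2≤ωR)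
                    (≤-trans big (≤-trans (≤-reflexive (≡.sym (∣moveSet∣≡∣S∣ u∈X v∉X))) ∣X′∣≤ωL+1)))
    where
    X′ = moveSet X u v
    X′∩R⊆⁅v⁆ : X′ ∩ right J ⊆ ⁅ v ⁆
    X′∩R⊆⁅v⁆ {y} y∈ with x∈p∩q⁻ X′ _ y∈
    ... | y∈X′ , y∈R with ∈-moveSet⁻ X u v y∈X′
    ...   | inj₁ refl      = x∈⁅x⁆ v
    ...   | inj₂ (_ , y∈X) = ⊥-elim (offR (y , x∈p∩q⁺ (y∈X , y∈R)))
    ∣X′∣≤ωL+1 : ∣ X′ ∣ ≤ ωL + 1
    ∣X′∣≤ωL+1 = ≤-trans (GP∧meets-right⇒∣∣≤ J boundL gp′ meetsR)
                        (+-monoʳ-≤ ωL (≤-trans (p⊆q⇒∣p∣≤∣q∣ X′∩R⊆⁅v⁆) (≤-reflexive (∣⁅x⁆∣≡1 v))))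
  ... | s≤s ()

  off-right-forever : (J : JoinSplit) → ∀ {ωL ωR} → CliqueBound (left J) ωL → 2 ≤ ωR →
                      ∀ {S X} → ωL + ωR ≤ ∣ S ∣ → Empty (S ∩ right J) → Reach S X → Empty (X ∩ right J)
  off-right-forever J {ωL} {ωR} boundL 2≤ωR big offR S→X =
    proj₂ (Reach-invariant (λ X → ωL + ωR ≤ ∣ X ∣ × Empty (X ∩ right J)) preserved (big , offR) S→X)
    where
    preserved : ∀ {X Y} → ωL + ωR ≤ ∣ X ∣ × Empty (X ∩ right J) → LegalMove Γ X Y →
                ωL + ωR ≤ ∣ Y ∣ × Empty (Y ∩ right J)
    preserved (big , offR) m = ≤-trans big (≤-reflexive (≡.sym (LegalMove⇒∣∣≡ m))) ,
                               off-right-preserved J boundL 2≤ωR big offR m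

  large-mobile⇒complete : (J : JoinSplit) → Nonempty (left J) → Nonempty (right J) →
                          ∀ {ωL ωR} → CliqueBound (left J) ωL → CliqueBound (right J) ωR → 2 ≤ ωL → 2 ≤ ωR →
                          ∀ {S} → IsMobileGP Γ S → ωL + ωR ≤ ∣ S ∣ → Complete Γ
  large-mobile⇒complete J (p , p∈L) (q , q∈R) {ωL} {ωR} boundL boundR 2≤ωL 2≤ωR {S} mobile@(gp , _) big
    with nonempty? (S ∩ left J) | nonempty? (S ∩ right J)
  ... | yes meetsL | yes meetsR = λ x y → mixed-GP⇒clique J gp meetsL meetsR x y (occupied x) (occupied y)
    where
    occupied : ∀ x → x ∈ S
    occupied x = frozen-Visits⇒∈ (large-mixed-frozen J boundL boundR 2≤ωL 2≤ωR gp meetsL meetsR big)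
                                 (mobile⇒Visits mobile x)
  ... | _ | no offR with mobile⇒Visits mobile q
  ...   | X , S→X , q∈X = ⊥-elim (off-right-forever J boundL 2≤ωR big offR S→X (q , x∈p∩q⁺ (q∈X , q∈R)))
  large-mobile⇒complete J (p , p∈L) _ {ωL} {ωR} boundL boundR 2≤ωL 2≤ωR {S} mobile big | no offL | yes _
    with mobile⇒Visits mobile p
  ... | X , S→X , p∈X =
    ⊥-elim (off-right-forever (swap J) boundR 2≤ωL (≤-trans (≤-reflexive (+-comm ωR ωL)) big)
                              offL S→X (p , x∈p∩q⁺ (p∈X , p∈L)))

  mobile⇒∣∣≤ω+∣right∣ : (J : JoinSplit) → ∀ {ω} → CliqueBound (left J) ω → Nonempty (right J) →
                        ∀ {S} → IsMobileGP Γ S → ∣ S ∣ ≤ ω + ∣ right J ∣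
  mobile⇒∣∣≤ω+∣right∣ J {ω} boundL (q , q∈R) {S} mobile@(gp , _) with mobile⇒Visits mobile q
  ... | X , S→X , q∈X = begin
    ∣ S ∣                ≡⟨ ≡.sym (Reach⇒∣∣≡ S→X) ⟩
    ∣ X ∣                ≤⟨ GP∧meets-right⇒∣∣≤ J boundL (Reach⇒GP gp S→X) (q , x∈p∩q⁺ (q∈X , q∈R)) ⟩
    ω + ∣ X ∩ right J ∣  ≤⟨ +-monoʳ-≤ ω (∣p∩q∣≤∣q∣ X (right J)) ⟩
    ω + ∣ right J ∣      ∎
    where open ≤-Reasoning

  cliques-∪ : (J : JoinSplit) → ∀ {A B} → IsClique Γ A → A ⊆ left J → IsClique Γ B → B ⊆ right J →
              IsClique Γ (A ∪ B)
  cliques-∪ J {A} {B} A-clique A⊆L B-clique B⊆R a b a∈ b∈ a≢b with x∈p∪q⁻ A B a∈ | x∈p∪q⁻ A B b∈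
  ... | inj₁ a∈A | inj₁ b∈A = A-clique a b a∈A b∈A a≢b
  ... | inj₁ a∈A | inj₂ b∈B = left-right-adj J (A⊆L a∈A) (B⊆R b∈B)
  ... | inj₂ a∈B | inj₁ b∈A = Adj-sym (left-right-adj J (A⊆L b∈A) (B⊆R a∈B))
  ... | inj₂ a∈B | inj₂ b∈B = B-clique a b a∈B b∈B a≢b

  left-Visits : (J : JoinSplit) → Diameter≤2 → ∀ {A B b₀ x} →
                IsClique Γ A → A ⊆ left J → IsClique Γ B → B ⊆ right J → ∣ A ∣ ≡ ∣ B ∣ → b₀ ∈ B → x ∈ left J →
                ∃[ Y ] (Y ⊆ A ∪ B × ∣ Y ∣ ≡ suc ∣ B ∣ × Visits Y x)
  left-Visits J diam {A} {B} {b₀} {x} A-clique A⊆L B-clique B⊆R ∣A∣≡∣B∣ b₀∈B x∈L =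
    visit (x ∈? A) (any? (λ a → a ∈? A ×-dec T? (adj Γ a x)))
    where
    b₀A⊆A∪B : ⁅ b₀ ⁆ ∪ A ⊆ A ∪ B
    b₀A⊆A∪B = ⁅x⁆∪p⊆q (q⊆p∪q A B b₀∈B) (p⊆p∪q B)
    ∣b₀A∣ : ∣ ⁅ b₀ ⁆ ∪ A ∣ ≡ suc ∣ B ∣
    ∣b₀A∣ = ≡.trans (∣⁅x⁆∪p∣≡1+∣p∣ A (λ b₀∈A → left⇒∉right J (A⊆L b₀∈A) (B⊆R b₀∈B))) (cong suc ∣A∣≡∣B∣)
    visit : Dec (x ∈ A) → Dec (∃[ a ] (a ∈ A × Adj Γ a x)) → ∃[ Y ] (Y ⊆ A ∪ B × ∣ Y ∣ ≡ suc ∣ B ∣ × Visits Y x)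
    visit (yes x∈A) _ = ⁅ b₀ ⁆ ∪ A , b₀A⊆A∪B , ∣b₀A∣ , _ , ε , x∈p∪q⁺ (inj₂ x∈A)
    visit (no x∉A) (yes (a , a∈A , a~x)) =
      ⁅ a ⁆ ∪ B , ⁅x⁆∪p⊆q (p⊆p∪q B a∈A) (q⊆p∪q A B) ,
      ∣⁅x⁆∪p∣≡1+∣p∣ B (left⇒∉right J (A⊆L a∈A) ∘ B⊆R) ,
      Visits-replace a~x x∉aB (clique⇒GP diam (clique-⁅⁆∪ B-clique (λ y∈B _ → left-right-adj J x∈L (B⊆R y∈B))))
      where
      x∉aB : x ∉ ⁅ a ⁆ ∪ B
      x∉aB x∈ with ∈⁅x⁆∪⁻ B x∈
      ... | inj₁ refl = x∉A a∈A
      ... | inj₂ x∈B  = left⇒∉right J x∈L (B⊆R x∈B)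
    visit (no x∉A) (no ∄a~x) =
      ⁅ b₀ ⁆ ∪ A , b₀A⊆A∪B , ∣b₀A∣ ,
      Visits-replace (Adj-sym (left-right-adj J x∈L (B⊆R b₀∈B))) x∉b₀A
        (NoInducedP₃⇒GP diam (NoInducedP₃-⁅⁆∪ (clique⇒NoInducedP₃ A-clique)
                                                (λ y∈A x~y → ∄a~x (_ , y∈A , Adj-sym x~y))))
      where
      x∉b₀A : x ∉ ⁅ b₀ ⁆ ∪ A
      x∉b₀A x∈ with ∈⁅x⁆∪⁻ A x∈
      ... | inj₁ refl = left⇒∉right J x∈L (B⊆R b₀∈B)
      ... | inj₂ x∈A  = x∉A x∈A

  cliques⇒mob≥1+∣B∣ : (J : JoinSplit) → ∀ {A B a₀ b₀} → IsClique Γ A → A ⊆ left J → IsClique Γ B → B ⊆ right J →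
                     ∣ A ∣ ≡ ∣ B ∣ → a₀ ∈ A → b₀ ∈ B → MobAtLeast Γ (suc ∣ B ∣)
  cliques⇒mob≥1+∣B∣ J {A} {B} {a₀} {b₀} A-clique A⊆L B-clique B⊆R ∣A∣≡∣B∣ a₀∈A b₀∈B =
    C , Visits⇒mobile (clique⇒GP diam (IsClique-⊆ C⊆K K-clique)) visits , ≤-reflexive (≡.sym ∣C∣≡1+∣B∣)
    where
    diam = diameter≤2 J (a₀ , A⊆L a₀∈A) (b₀ , B⊆R b₀∈B)
    C = ⁅ a₀ ⁆ ∪ B
    K-clique = cliques-∪ J A-clique A⊆L B-clique B⊆R
    C⊆K : C ⊆ A ∪ B
    C⊆K = ⁅x⁆∪p⊆q (p⊆p∪q B a₀∈A) (q⊆p∪q A B)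
    ∣C∣≡1+∣B∣ : ∣ C ∣ ≡ suc ∣ B ∣
    ∣C∣≡1+∣B∣ = ∣⁅x⁆∪p∣≡1+∣p∣ B (left⇒∉right J (A⊆L a₀∈A) ∘ B⊆R)
    visits : ∀ x → Visits C x
    visits x with left-or-right J x
    ... | inj₁ x∈L with left-Visits J diam A-clique A⊆L B-clique B⊆R ∣A∣≡∣B∣ b₀∈B x∈L
    ...   | Y , Y⊆K , ∣Y∣≡ , Y-visits =
      Visits-◅◅ (clique-Reach diam K-clique C⊆K Y⊆K (≡.trans ∣C∣≡1+∣B∣ (≡.sym ∣Y∣≡))) Y-visits
    visits x | inj₂ x∈R with left-Visits (swap J) diam B-clique B⊆R A-clique A⊆L (≡.sym ∣A∣≡∣B∣) a₀∈A x∈R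
    ...   | Y , Y⊆K , ∣Y∣≡ , Y-visits =
      Visits-◅◅ (clique-Reach diam K-clique C⊆K (subst (Y ⊆_) (∪-comm B A) Y⊆K)
                              (≡.trans ∣C∣≡1+∣B∣ (≡.sym (≡.trans ∣Y∣≡ (cong suc ∣A∣≡∣B∣))))) Y-visits

  mob≥⊓+1 : (J : JoinSplit) → ∀ {ωL ωR} → HasClique (left J) ωL → HasClique (right J) ωR → 1 ≤ ωL ⊓ ωR →
            MobAtLeast Γ (ωL ⊓ ωR + 1)
  mob≥⊓+1 J {ωL} {ωR} (A′ , A′-clique , A′⊆L , ∣A′∣≡ωL) (B′ , B′-clique , B′⊆R , ∣B′∣≡ωR) 1≤k
    with ∃⊆-of-size A′ (subst (ωL ⊓ ωR ≤_) (≡.sym ∣A′∣≡ωL) (m⊓n≤m ωL ωR))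
       | ∃⊆-of-size B′ (subst (ωL ⊓ ωR ≤_) (≡.sym ∣B′∣≡ωR) (m⊓n≤n ωL ωR))
  ... | A , A⊆A′ , ∣A∣≡k | B , B⊆B′ , ∣B∣≡k
    with 1≤∣p∣⇒Nonempty A (subst (1 ≤_) (≡.sym ∣A∣≡k) 1≤k) | 1≤∣p∣⇒Nonempty B (subst (1 ≤_) (≡.sym ∣B∣≡k) 1≤k)
  ... | a₀ , a₀∈A | b₀ , b₀∈B =
    subst (MobAtLeast Γ) (≡.trans (cong suc ∣B∣≡k) (+-comm 1 (ωL ⊓ ωR)))
      (cliques⇒mob≥1+∣B∣ J (IsClique-⊆ A⊆A′ A′-clique) (⊆-trans A⊆A′ A′⊆L)
                           (IsClique-⊆ B⊆B′ B′-clique) (⊆-trans B⊆B′ B′⊆R)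
                           (≡.trans ∣A∣≡k (≡.sym ∣B∣≡k)) a₀∈A b₀∈B)

∈-++⁺ˡ : ∀ {n m} {A : Subset n} {B : Subset m} {a} → a ∈ A → a ↑ˡ m ∈ A ++ B
∈-++⁺ˡ here        = here
∈-++⁺ˡ (there a∈A) = there (∈-++⁺ˡ a∈A)

∈-++⁻ˡ : ∀ {n m} (A : Subset n) {B : Subset m} {a} → a ↑ˡ m ∈ A ++ B → a ∈ A
∈-++⁻ˡ (_ ∷ A) {a = zero}  here       = here
∈-++⁻ˡ (_ ∷ A) {a = suc a} (there a∈) = there (∈-++⁻ˡ A a∈)

∈-++⁺ʳ : ∀ {n m} (A : Subset n) {B : Subset m} {b} → b ∈ B → n ↑ʳ b ∈ A ++ B
∈-++⁺ʳ []      b∈B = b∈B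
∈-++⁺ʳ (_ ∷ A) b∈B = there (∈-++⁺ʳ A b∈B)

∈-++⁻ʳ : ∀ {n m} (A : Subset n) {B : Subset m} {b} → n ↑ʳ b ∈ A ++ B → b ∈ B
∈-++⁻ʳ []      b∈         = b∈
∈-++⁻ʳ (_ ∷ A) (there b∈) = ∈-++⁻ʳ A b∈

∣p++q∣≡∣p∣+∣q∣ : ∀ {n m} (p : Subset n) (q : Subset m) → ∣ p ++ q ∣ ≡ ∣ p ∣ + ∣ q ∣
∣p++q∣≡∣p∣+∣q∣ []          q = refl
∣p++q∣≡∣p∣+∣q∣ (true ∷ p)  q = cong suc (∣p++q∣≡∣p∣+∣q∣ p q)
∣p++q∣≡∣p∣+∣q∣ (false ∷ p) q = ∣p++q∣≡∣p∣+∣q∣ p q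

↑-view : ∀ n {m} (x : Fin (n + m)) → (∃[ a ] x ≡ a ↑ˡ m) ⊎ (∃[ b ] x ≡ n ↑ʳ b)
↑-view n x with splitAt n x in eq
... | inj₁ a = inj₁ (a , ≡.sym (splitAt⁻¹-↑ˡ eq))
... | inj₂ b = inj₂ (b , ≡.sym (splitAt⁻¹-↑ʳ eq))

++⁺-⊆ : ∀ {n m} {A A′ : Subset n} {B B′ : Subset m} → A ⊆ A′ → B ⊆ B′ → A ++ B ⊆ A′ ++ B′
++⁺-⊆ {n} {A = A} A⊆A′ B⊆B′ {x} x∈ with ↑-view n x
... | inj₁ (a , refl) = ∈-++⁺ˡ (A⊆A′ (∈-++⁻ˡ A x∈))
... | inj₂ (b , refl) = ∈-++⁺ʳ _ (B⊆B′ (∈-++⁻ʳ A x∈))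

module _ {n m : ℕ} (G : Graph n) (H : Graph m) where

  private
    Γ = G ∨ᴳ H

  adj-↑ˡ↑ˡ : ∀ a b → adj Γ (a ↑ˡ m) (b ↑ˡ m) ≡ adj G a b
  adj-↑ˡ↑ˡ a b rewrite splitAt-↑ˡ n a m | splitAt-↑ˡ n b m = refl

  adj-↑ʳ↑ʳ : ∀ a b → adj Γ (n ↑ʳ a) (n ↑ʳ b) ≡ adj H a b
  adj-↑ʳ↑ʳ a b rewrite splitAt-↑ʳ n m a | splitAt-↑ʳ n m b = refl

  adj-↑ˡ↑ʳ : ∀ a b → adj Γ (a ↑ˡ m) (n ↑ʳ b) ≡ true
  adj-↑ˡ↑ʳ a b rewrite splitAt-↑ˡ n a m | splitAt-↑ʳ n m b = refl

  ↑ˡ∈⊤++⊥ : ∀ {a} → a ↑ˡ m ∈ ⊤ {n} ++ ⊥ {m}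
  ↑ˡ∈⊤++⊥ = ∈-++⁺ˡ ∈⊤

  ↑ʳ∈⊥++⊤ : ∀ {b} → n ↑ʳ b ∈ ⊥ {n} ++ ⊤ {m}
  ↑ʳ∈⊥++⊤ = ∈-++⁺ʳ (⊥ {n}) ∈⊤

  ∨-split : JoinSplit Γ
  ∨-split = record
    { left           = ⊤ {n} ++ ⊥ {m}
    ; right          = ⊥ {n} ++ ⊤ {m}
    ; left-or-right  = λ x → case ↑-view n x of λ where
        (inj₁ (_ , refl)) → inj₁ ↑ˡ∈⊤++⊥
        (inj₂ (_ , refl)) → inj₂ ↑ʳ∈⊥++⊤
    ; left-right-adj = cross
    }
    where
    cross : ∀ {x y} → x ∈ ⊤ {n} ++ ⊥ {m} → y ∈ ⊥ {n} ++ ⊤ {m} → Adj Γ x y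
    cross {x} {y} x∈L y∈R with ↑-view n x | ↑-view n y
    ... | inj₁ (a , refl) | inj₂ (b , refl) = subst T (≡.sym (adj-↑ˡ↑ʳ a b)) tt
    ... | inj₂ (_ , refl) | _               = ⊥-elim (∉⊥ (∈-++⁻ʳ (⊤ {n}) x∈L))
    ... | inj₁ _          | inj₁ (_ , refl) = ⊥-elim (∉⊥ (∈-++⁻ˡ (⊥ {n}) y∈R))

  clique-++⁻ : ∀ A B → IsClique Γ (A ++ B) → IsClique G A × IsClique H B
  clique-++⁻ A B clique =
    (λ a b a∈A b∈A a≢b → subst T (adj-↑ˡ↑ˡ a b)
       (clique _ _ (∈-++⁺ˡ a∈A) (∈-++⁺ˡ b∈A) (a≢b ∘ ↑ˡ-injective m a b))) ,
    (λ a b a∈B b∈B a≢b → subst T (adj-↑ʳ↑ʳ a b)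
       (clique _ _ (∈-++⁺ʳ A a∈B) (∈-++⁺ʳ A b∈B) (a≢b ∘ ↑ʳ-injective n a b)))

  clique-++⁺ : ∀ A B → IsClique G A → IsClique H B → IsClique Γ (A ++ B)
  clique-++⁺ A B A-clique B-clique x y x∈ y∈ x≢y with ↑-view n x | ↑-view n y
  ... | inj₁ (a , refl) | inj₁ (b , refl) =
    subst T (≡.sym (adj-↑ˡ↑ˡ a b)) (A-clique a b (∈-++⁻ˡ A x∈) (∈-++⁻ˡ A y∈) (x≢y ∘ cong (_↑ˡ m)))
  ... | inj₂ (a , refl) | inj₂ (b , refl) =
    subst T (≡.sym (adj-↑ʳ↑ʳ a b)) (B-clique a b (∈-++⁻ʳ A x∈) (∈-++⁻ʳ A y∈) (x≢y ∘ cong (n ↑ʳ_)))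
  ... | inj₁ (_ , refl) | inj₂ (_ , refl) = left-right-adj ∨-split ↑ˡ∈⊤++⊥ ↑ʳ∈⊥++⊤
  ... | inj₂ (_ , refl) | inj₁ (_ , refl) = Adj-sym Γ (left-right-adj ∨-split ↑ˡ∈⊤++⊥ ↑ʳ∈⊥++⊤)

  left-CliqueBound : ∀ {w} → (∀ S → IsClique G S → ∣ S ∣ ≤ w) → CliqueBound Γ (left ∨-split) w
  left-CliqueBound {w} boundG X clique X⊆L with Data.Vec.splitAt n X
  ... | A , B , refl = begin
    ∣ A ++ B ∣     ≡⟨ ∣p++q∣≡∣p∣+∣q∣ A B ⟩
    ∣ A ∣ + ∣ B ∣  ≤⟨ +-mono-≤ (boundG A (proj₁ (clique-++⁻ A B clique))) ∣B∣≤0 ⟩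
    w + 0          ≡⟨ +-identityʳ w ⟩
    w              ∎
    where
    open ≤-Reasoning
    ∣B∣≤0 : ∣ B ∣ ≤ 0
    ∣B∣≤0 = ≤-trans (p⊆q⇒∣p∣≤∣q∣ (λ b∈B → ∈-++⁻ʳ (⊤ {n}) (X⊆L (∈-++⁺ʳ A b∈B)))) (≤-reflexive (∣⊥∣≡0 m))

  right-CliqueBound : ∀ {w} → (∀ S → IsClique H S → ∣ S ∣ ≤ w) → CliqueBound Γ (right ∨-split) w
  right-CliqueBound {w} boundH X clique X⊆R with Data.Vec.splitAt n X
  ... | A , B , refl = begin
    ∣ A ++ B ∣     ≡⟨ ∣p++q∣≡∣p∣+∣q∣ A B ⟩
    ∣ A ∣ + ∣ B ∣  ≤⟨ +-mono-≤ ∣A∣≤0 (boundH B (proj₂ (clique-++⁻ A B clique))) ⟩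
    0 + w          ∎
    where
    open ≤-Reasoning
    ∣A∣≤0 : ∣ A ∣ ≤ 0
    ∣A∣≤0 = ≤-trans (p⊆q⇒∣p∣≤∣q∣ (λ a∈A → ∈-++⁻ˡ (⊥ {n}) (X⊆R (∈-++⁺ˡ {B = B} a∈A)))) (≤-reflexive (∣⊥∣≡0 n))

  left-HasClique : ∀ {w} → IsCliqueNumber G w → HasClique Γ (left ∨-split) w
  left-HasClique {w} ((A , A-clique , ∣A∣≡w) , _) =
    A ++ ⊥ , clique-++⁺ A ⊥ A-clique (λ _ _ x∈⊥ → ⊥-elim (∉⊥ x∈⊥)) , ++⁺-⊆ {A = A} {B = ⊥} ⊆⊤ (λ x∈⊥ → x∈⊥) ,
    ≡.trans (∣p++q∣≡∣p∣+∣q∣ A ⊥) (≡.trans (cong₂ _+_ ∣A∣≡w (∣⊥∣≡0 m)) (+-identityʳ w))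

  right-HasClique : ∀ {w} → IsCliqueNumber H w → HasClique Γ (right ∨-split) w
  right-HasClique {w} ((B , B-clique , ∣B∣≡w) , _) =
    ⊥ ++ B , clique-++⁺ ⊥ B (λ _ _ x∈⊥ → ⊥-elim (∉⊥ x∈⊥)) B-clique , ++⁺-⊆ {A = ⊥} {B = B} (λ x∈⊥ → x∈⊥) ⊆⊤ ,
    ≡.trans (∣p++q∣≡∣p∣+∣q∣ (⊥ {n}) B) (cong₂ _+_ (∣⊥∣≡0 n) ∣B∣≡w)

  ∨-Complete⁻ : Complete Γ → Complete G × Complete H
  ∨-Complete⁻ complete with clique-++⁻ ⊤ ⊤ (λ x y _ _ → complete x y)
  ... | G-complete , H-complete = (λ a b → G-complete a b ∈⊤ ∈⊤) , (λ a b → H-complete a b ∈⊤ ∈⊤)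

G∨H-mob-bounds : ∀ {n m} (G : Graph n) (H : Graph m) (wG wH : ℕ) →
                 IsCliqueNumber G wG → IsCliqueNumber H wH → 2 ≤ wG → 2 ≤ wH → ¬ (Complete G × Complete H) →
                 MobAtLeast (G ∨ᴳ H) ((wG ⊓ wH) + 1) × MobAtMost (G ∨ᴳ H) (wG + wH ∸ 1)
G∨H-mob-bounds G H wG wH ωG ωH 2≤wG 2≤wH ¬complete =
  mob≥⊓+1 Γ J cliqueL cliqueR (⊓-glb 1≤wG 1≤wH) ,
  λ S mobile → <⇒≤pred (≰⇒> λ big → ¬complete (∨-Complete⁻ G H
    (large-mobile⇒complete Γ J (HasClique⇒Nonempty Γ cliqueL 1≤wG) (HasClique⇒Nonempty Γ cliqueR 1≤wH)
                               (left-CliqueBound G H (proj₂ ωG)) (right-CliqueBound G H (proj₂ ωH))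
                               2≤wG 2≤wH mobile big)))
  where
  Γ = G ∨ᴳ H
  J = ∨-split G H
  cliqueL = left-HasClique G H ωG
  cliqueR = right-HasClique G H ωH
  1≤wG = ≤-trans (s≤s z≤n) 2≤wG
  1≤wH = ≤-trans (s≤s z≤n) 2≤wH

G∨K₁-mob-bounds : ∀ {n} (G : Graph n) (w : ℕ) → 2 ≤ n → IsCliqueNumber G w →
                  MobAtLeast (G ∨ᴳ K₁) 2 × MobAtMost (G ∨ᴳ K₁) (w + 1)
G∨K₁-mob-bounds {suc n} G w _ (_ , boundG) =
  universal-vertex⇒mob≥2 Γ {g = zero} apex-universal (λ ()) ,
  λ S mobile → ≤-trans (mobile⇒∣∣≤ω+∣right∣ Γ J (left-CliqueBound G K₁ boundG) (apex , ↑ʳ∈⊥++⊤ G K₁) mobile)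
                       (≤-reflexive (cong (w +_) ∣right∣≡1))
  where
  Γ = G ∨ᴳ K₁
  J = ∨-split G K₁
  apex = suc n ↑ʳ zero
  apex-universal : ∀ x → x ≢ apex → Adj Γ apex x
  apex-universal x x≢apex with ↑-view (suc n) x
  ... | inj₁ (a , refl)    = left-right-adj (swap Γ J) (↑ʳ∈⊥++⊤ G K₁) (↑ˡ∈⊤++⊥ G K₁ {a})
  ... | inj₂ (zero , refl) = ⊥-elim (x≢apex refl)
  ∣right∣≡1 : ∣ right J ∣ ≡ 1
  ∣right∣≡1 = ≡.trans (∣p++q∣≡∣p∣+∣q∣ (⊥ {suc n}) (⊤ {1})) (cong₂ _+_ (∣⊥∣≡0 (suc n)) (∣⊤∣≡n 1))

theorem4p4 :
    (∀ {n m} (G : Graph n) (H : Graph m) (wG wH : ℕ) →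
      IsCliqueNumber G wG → IsCliqueNumber H wH →
      2 ≤ wG → 2 ≤ wH → ¬ (Complete G × Complete H) →
      MobAtLeast (G ∨ᴳ H) ((wG ⊓ wH) + 1) × MobAtMost (G ∨ᴳ H) (wG + wH ∸ 1))
    ×
    (∀ {n} (G : Graph n) (w : ℕ) → 2 ≤ n → IsCliqueNumber G w →
      MobAtLeast (G ∨ᴳ K₁) 2 × MobAtMost (G ∨ᴳ K₁) (w + 1))
theorem4p4 = G∨H-mob-bounds , G∨K₁-mob-bounds
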